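{- For all integers $s \geq 1$ and $t \geq 2$, \[ \mathbb P(s,t) \geq \frac{1}{\binom{R(s,t)}{s}}, \] and for every integer $a$ with $2 \leq a < s$, \[ \mathbb P(s,t) \leq \binom{R(a,t)-1}{a-1} \left( \frac{a-1}{R(a,t)-1} \right)^{s}. \]
   Context: All graphs are finite simple graphs with at least one vertex. For integers $s \geq 1$ and $t \geq 2$, $\mathbb P(s,t)$ is the infimum, over all graphs $G$ containing no clique on $t$ vertices, of the probability that, when $v_1,\dots,v_s$ are vertices of $G$ chosen independently and uniformly at random (repetitions allowed), the set $\{v_1,\dots,v_s\}$ is an independent set of $G$. The two-color Ramsey number $R(s,t)$ is the minimum $n$ such that every graph on $n$ vertices contains an independent set of size $s$ or a clique of size $t$. -}

module Defs where

open import Data.Bool using (Bool; true; false)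
open import Data.Nat as ℕ using (ℕ; zero; suc; _≤_)
open import Data.Fin using (Fin)
open import Data.Fin.Properties using (all?)
open import Data.Integer using (+_)
open import Data.Rational using (ℚ; _/_; _*_; 1ℚ; 0ℚ)
open import Data.Product using (Σ; _×_)
open import Data.Sum using (_⊎_)
open import Data.List using (List; map; allFin)
open import Data.Nat.ListAction using (sum)
open import Data.Vec.Functional using (_∷_; [])
open import Function.Definitions using (Injective)
open import Relation.Binary.PropositionalEquality using (_≡_; _≢_)
open import Relation.Nullary using (¬_; Dec; yes; no)
open import Relation.Unary using (Decidable)
open import Data.Bool.Properties using () renaming (_≟_ to _≟B_)

record SimpleGraph (n : ℕ) : Set where
  field
    adj    : Fin n → Fin n → Bool
    sym    : ∀ u v → adj u v ≡ adj v u
    irrefl : ∀ v → adj v v ≡ false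
open SimpleGraph public

HasClique : ∀ {n} → SimpleGraph n → ℕ → Set
HasClique {n} G t =
  Σ (Fin t → Fin n) λ f → Injective _≡_ _≡_ f × (∀ i j → i ≢ j → adj G (f i) (f j) ≡ true)

HasIndependentSet : ∀ {n} → SimpleGraph n → ℕ → Set
HasIndependentSet {n} G s =
  Σ (Fin s → Fin n) λ f → Injective _≡_ _≡_ f × (∀ i j → i ≢ j → adj G (f i) (f j) ≡ false)

CliqueFree : ∀ {n} → SimpleGraph n → ℕ → Set
CliqueFree G t = ¬ HasClique G t

RamseyProperty : ℕ → ℕ → ℕ → Set
RamseyProperty s t n = (G : SimpleGraph n) → HasIndependentSet G s ⊎ HasClique G t

IsRamseyNumber : ℕ → ℕ → ℕ → Set
IsRamseyNumber s t r = RamseyProperty s t r × (∀ n → RamseyProperty s t n → r ≤ n)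

-- The set {v 0, …, v (s-1)} (a tuple with repetitions allowed) is independent.
IsIndependentTuple : ∀ {n s} → SimpleGraph n → (Fin s → Fin n) → Set
IsIndependentTuple G v = ∀ i j → adj G (v i) (v j) ≡ false

isIndependentTuple? : ∀ {n s} (G : SimpleGraph n) → Decidable (IsIndependentTuple {n} {s} G)
isIndependentTuple? G v = all? λ i → all? λ j → adj G (v i) (v j) ≟B false

countTuples : ∀ n s {P : (Fin s → Fin n) → Set} → Decidable P → ℕ
countTuples n zero {P} P? with P? []
... | yes _ = 1
... | no _  = 0
countTuples n (suc s) {P} P? =
  sum (map (λ x → countTuples n s {λ f → P (x ∷ f)} (λ f → P? (x ∷ f))) (allFin n))

-- p / q as a rational (convention: value 0 when q = 0; only used with q ≠ 0)
frac : ℕ → ℕ → ℚ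
frac p zero    = 0ℚ
frac p (suc q) = (+ p) / suc q

_^ℚ_ : ℚ → ℕ → ℚ
q ^ℚ zero  = 1ℚ
q ^ℚ suc k = q * (q ^ℚ k)

-- Probability that s independent uniform vertices of G form an independent set.
indepProb : ∀ {n} → SimpleGraph n → ℕ → ℚ
indepProb {n} G s = frac (countTuples n s (isIndependentTuple? {n} {s} G)) (n ℕ.^ s)

-- Let G be K_t-free on n vertices and r = R(s,t).  For every r-tuple w of
-- vertices, the graph pulled back along w has no t-clique, hence an independent s-set, so
-- some s-subsequence of w is an independent tuple of G.  Every s-tuple is a subsequence of
-- exactly (r C s) · n^(r-s) of the r-tuples, hence n^r ≤ (r C s) · n^(r-s) · I, where I is
-- the number of independent s-tuples; that is, I / n^s ≥ 1 / (r C s).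
--
-- By minimality of r = R(a,t) there is a graph H on r - 1 vertices with
-- neither an independent a-set nor a t-clique.  An independent tuple of H takes at most
-- a - 1 distinct values, so it lies in one of the (r-1 C a-1) sets of a - 1 vertices, each
-- of which carries (a-1)^s tuples.

module Submission where

open import Defs hiding (sym)
open import Data.Nat using (ℕ; suc; _≤_; _<_; _∸_)
open import Data.Nat.Combinatorics using (_C_)
open import Data.Rational using (ℚ; 0ℚ) renaming (_≤_ to _≤ℚ_; _<_ to _<ℚ_; _+_ to _+ℚ_; _*_ to _*ℚ_)
open import Data.Product using (Σ; _×_)

open import Data.Bool using (Bool; true; false)
open import Data.Bool.Properties using () renaming (_≟_ to _≟ᵇ_)
open import Data.Empty using (⊥-elim)
open import Data.Fin using (Fin; zero; suc; punchIn; punchOut)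
import Data.Fin.Properties as Finₚ
open import Data.Fin.Subset using (Subset)
open import Data.Fin.Subset.Properties using (anySubset?)
import Data.Integer as ℤ
import Data.Integer.Properties as ℤₚ
open import Data.List as List using (List; map; _++_; concatMap; allFin; length)
open import Data.List.Properties using (map-cong; map-++; map-∘; map-tabulate; length-tabulate; length-map; length-++)
open import Data.List.Membership.Propositional using (lose)
open import Data.List.Membership.Propositional.Properties using (∈-allFin)
open import Data.List.Relation.Unary.Any as Any using (Any; here; there)
open import Data.List.Relation.Unary.Any.Properties using (map⁺; ++⁺ˡ; ++⁺ʳ)
open import Data.Nat using (zero; _+_; _*_; _^_; z≤n; s≤s; _≤?_; NonZero)
open import Data.Nat.Combinatorics using (nCk+nC[k+1]≡[n+1]C[k+1])
open import Data.Nat.ListAction using (sum)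
open import Data.Nat.ListAction.Properties using (sum-++)
open import Data.Nat.Properties
open import Data.Nat.Solver using (module +-*-Solver)
open import Algebra.Properties.CommutativeSemigroup +-commutativeSemigroup using (interchange)
open import Algebra.Properties.CommutativeSemigroup *-commutativeSemigroup
  using () renaming (xy∙z≈xz∙y to *-xy∙z≈xz∙y)
open import Data.Product using (∃; _,_; proj₁; proj₂)
open import Data.Rational using (toℚᵘ)
import Data.Rational.Properties as ℚₚ
open import Data.Rational.Unnormalised as ℚᵘ using (mkℚᵘ; *≤*; *≡*) renaming (_≃_ to _≃ᵘ_)
import Data.Rational.Unnormalised.Properties as ℚᵘₚ
open import Data.Sum using (inj₁; inj₂)
open import Data.Vec as Vec using (Vec; lookup; tabulate)
import Data.Vec.Properties as Vecₚ
open import Data.Vec.Functional using ([]; _∷_; head; tail)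
open import Function using (_∘_; id)
open import Function.Definitions using (Injective)
open import Relation.Binary.PropositionalEquality
open import Relation.Nullary using (¬_; Dec; yes; no)
open import Relation.Nullary.Decidable using (map′; _×-dec_; _→-dec_; ¬?)
open import Relation.Unary using (Decidable)

private
  variable
    A B : Set

-- Indicators and finite sums

𝟙 : {P : Set} → Dec P → ℕ
𝟙 (yes _) = 1
𝟙 (no _)  = 0

𝟙≤1 : {P : Set} (d : Dec P) → 𝟙 d ≤ 1
𝟙≤1 (yes _) = s≤s z≤n
𝟙≤1 (no _)  = z≤n

𝟙-yes : {P : Set} (d : Dec P) → P → 𝟙 d ≡ 1
𝟙-yes (yes _) _ = refl
𝟙-yes (no ¬p) p = ⊥-elim (¬p p)

𝟙-× : {P Q R : Set} (p : Dec P) (q : Dec Q) (r : Dec R) →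
      (R → P × Q) → (P → Q → R) → 𝟙 r ≡ 𝟙 p * 𝟙 q
𝟙-× (yes _)  (yes _)  (yes _)  _    _    = refl
𝟙-× (yes p)  (yes q)  (no ¬r)  _    pq⇒r = ⊥-elim (¬r (pq⇒r p q))
𝟙-× (no ¬p)  _        (yes r)  r⇒pq _    = ⊥-elim (¬p (proj₁ (r⇒pq r)))
𝟙-× (yes _)  (no ¬q)  (yes r)  r⇒pq _    = ⊥-elim (¬q (proj₂ (r⇒pq r)))
𝟙-× (yes _)  (no _)   (no _)   _    _    = refl
𝟙-× (no _)   _        (no _)   _    _    = refl

∑ : List A → (A → ℕ) → ℕ
∑ xs f = sum (map f xs)

-- The body of ∑[ x ∈ xs ] e extends only over an application: ∑[ x ∈ xs ] f x ^ s is (∑ …) ^ s.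
syntax ∑ xs (λ x → e) = ∑[ x ∈ xs ] e

∑-cong : (xs : List A) {f g : A → ℕ} → (∀ x → f x ≡ g x) → ∑ xs f ≡ ∑ xs g
∑-cong xs f≗g = cong sum (map-cong f≗g xs)

∑-mono : (xs : List A) {f g : A → ℕ} → (∀ x → f x ≤ g x) → ∑ xs f ≤ ∑ xs g
∑-mono List.[]       _   = z≤n
∑-mono (x List.∷ xs) f≤g = +-mono-≤ (f≤g x) (∑-mono xs f≤g)

∑-distrib-+ : (xs : List A) (f g : A → ℕ) → ∑[ x ∈ xs ] (f x + g x) ≡ ∑ xs f + ∑ xs g
∑-distrib-+ List.[]       f g = refl
∑-distrib-+ (x List.∷ xs) f g = trans (cong (f x + g x +_) (∑-distrib-+ xs f g))
                                      (interchange (f x) (g x) (∑ xs f) (∑ xs g))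

*-distribˡ-∑ : ∀ c (xs : List A) (f : A → ℕ) → c * ∑ xs f ≡ ∑[ x ∈ xs ] (c * f x)
*-distribˡ-∑ c List.[]       f = *-zeroʳ c
*-distribˡ-∑ c (x List.∷ xs) f =
  trans (*-distribˡ-+ c (f x) (∑ xs f)) (cong (c * f x +_) (*-distribˡ-∑ c xs f))

*-distribʳ-∑ : ∀ c (xs : List A) (f : A → ℕ) → ∑ xs f * c ≡ ∑[ x ∈ xs ] (f x * c)
*-distribʳ-∑ c xs f = trans (*-comm (∑ xs f) c)
  (trans (*-distribˡ-∑ c xs f) (∑-cong xs λ x → *-comm c (f x)))

∑-const : (xs : List A) (c : ℕ) → ∑[ _ ∈ xs ] c ≡ length xs * c
∑-const List.[]       c = refl
∑-const (x List.∷ xs) c = cong (c +_) (∑-const xs c)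

∑-++ : (xs ys : List A) (f : A → ℕ) → ∑ (xs ++ ys) f ≡ ∑ xs f + ∑ ys f
∑-++ xs ys f = trans (cong sum (map-++ f xs ys)) (sum-++ (map f xs) (map f ys))

∑-comm : (xs : List A) (ys : List B) (f : A → B → ℕ) →
         ∑[ x ∈ xs ] ∑[ y ∈ ys ] f x y ≡ ∑[ y ∈ ys ] ∑[ x ∈ xs ] f x y
∑-comm List.[]       ys f = sym (trans (∑-const ys 0) (*-zeroʳ (length ys)))
∑-comm (x List.∷ xs) ys f = trans (cong (∑ ys (f x) +_) (∑-comm xs ys f))
                                  (sym (∑-distrib-+ ys (f x) _))

∑-𝟙-Any : {P : A → Set} (P? : Decidable P) {xs : List A} → Any P xs → 1 ≤ ∑[ x ∈ xs ] 𝟙 (P? x)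
∑-𝟙-Any P? {x List.∷ _} (here px)  = ≤-trans (≤-reflexive (sym (𝟙-yes (P? x) px))) (m≤m+n _ _)
∑-𝟙-Any P? {x List.∷ _} (there pxs) = ≤-trans (∑-𝟙-Any P? pxs) (m≤n+m _ (𝟙 (P? x)))

∑-map : (h : A → B) (xs : List A) (f : B → ℕ) → ∑ (map h xs) f ≡ ∑[ x ∈ xs ] f (h x)
∑-map h xs f = cong sum (sym (map-∘ xs))

∑-concatMap : (h : A → List B) (xs : List A) (f : B → ℕ) →
              ∑ (concatMap h xs) f ≡ ∑[ x ∈ xs ] ∑ (h x) f
∑-concatMap h List.[]       f = refl
∑-concatMap h (x List.∷ xs) f =
  trans (∑-++ (h x) (concatMap h xs) f) (cong (∑ (h x) f +_) (∑-concatMap h xs f))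

∑-allFin-suc : ∀ n (f : Fin (suc n) → ℕ) → ∑ (allFin (suc n)) f ≡ f zero + ∑[ i ∈ allFin n ] f (suc i)
∑-allFin-suc n f = cong (f zero +_)
  (trans (cong sum (map-tabulate suc f)) (sym (cong sum (map-tabulate id (f ∘ suc)))))

∑-allFin-const : ∀ n c → ∑[ _ ∈ allFin n ] c ≡ n * c
∑-allFin-const n c = trans (∑-const (allFin n) c) (cong (_* c) (length-tabulate {n = n} id))

count : ∀ {n} {S : Fin n → Set} → Decidable S → ℕ
count {n} S? = ∑[ x ∈ allFin n ] 𝟙 (S? x)

count-suc : ∀ {n} {S : Fin (suc n) → Set} (S? : Decidable S) → count S? ≡ 𝟙 (S? zero) + count (S? ∘ suc)
count-suc {n} S? = ∑-allFin-suc n (𝟙 ∘ S?)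

count≤n : ∀ {n} {S : Fin n → Set} (S? : Decidable S) → count S? ≤ n
count≤n {n} S? = begin
  count S?              ≤⟨ ∑-mono (allFin n) (𝟙≤1 ∘ S?) ⟩
  ∑[ _ ∈ allFin n ] 1   ≡⟨ ∑-allFin-const n 1 ⟩
  n * 1                 ≡⟨ *-identityʳ n ⟩
  n                     ∎
  where open ≤-Reasoning

count≥1 : ∀ {n} {S : Fin n → Set} (S? : Decidable S) {x} → S x → 1 ≤ count S?
count≥1 {n} S? {x} sx = ∑-𝟙-Any S? (lose (∈-allFin x) sx)

-- Tuples and subsequences

tuples : ∀ n s → List (Fin s → Fin n)
tuples n zero    = List.[ [] ]
tuples n (suc s) = concatMap (λ x → map (x ∷_) (tuples n s)) (allFin n)

∑-tuples-suc : ∀ n s (f : (Fin (suc s) → Fin n) → ℕ) →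
               ∑ (tuples n (suc s)) f ≡ ∑[ x ∈ allFin n ] ∑[ u ∈ tuples n s ] f (x ∷ u)
∑-tuples-suc n s f = trans (∑-concatMap _ (allFin n) f)
                           (∑-cong (allFin n) λ x → ∑-map (x ∷_) (tuples n s) f)

∑-tuples-const : ∀ n s c → ∑[ _ ∈ tuples n s ] c ≡ n ^ s * c
∑-tuples-const n zero    c = refl
∑-tuples-const n (suc s) c = begin
  ∑[ _ ∈ tuples n (suc s) ] c                 ≡⟨ ∑-tuples-suc n s _ ⟩
  ∑[ _ ∈ allFin n ] ∑[ _ ∈ tuples n s ] c     ≡⟨ ∑-cong (allFin n) (λ _ → ∑-tuples-const n s c) ⟩
  ∑[ _ ∈ allFin n ] (n ^ s * c)               ≡⟨ ∑-allFin-const n _ ⟩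
  n * (n ^ s * c)                             ≡⟨ *-assoc n (n ^ s) c ⟨
  n ^ suc s * c                               ∎
  where open ≡-Reasoning

countTuples≡∑𝟙 : ∀ n s {P : (Fin s → Fin n) → Set} (P? : Decidable P) →
                 countTuples n s P? ≡ ∑[ u ∈ tuples n s ] 𝟙 (P? u)
countTuples≡∑𝟙 n zero P? with P? []
... | yes _ = refl
... | no _  = refl
countTuples≡∑𝟙 n (suc s) P? =
  trans (∑-cong (allFin n) λ x → countTuples≡∑𝟙 n s (P? ∘ (x ∷_))) (sym (∑-tuples-suc n s _))

∑-tuples-all : ∀ n s {Q : Fin n → Set} (Q? : Decidable Q) →
  ∑[ u ∈ tuples n s ] 𝟙 (Finₚ.all? (Q? ∘ u)) ≡ count Q? ^ s
∑-tuples-all n zero Q? = cong (_+ 0) (𝟙-yes (Finₚ.all? (Q? ∘ [])) λ ())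
∑-tuples-all n (suc s) {Q} Q? = begin
  ∑[ u ∈ tuples n (suc s) ] 𝟙 (all? u)
    ≡⟨ ∑-tuples-suc n s _ ⟩
  ∑[ x ∈ allFin n ] ∑[ u ∈ tuples n s ] 𝟙 (all? (x ∷ u))
    ≡⟨ ∑-cong (allFin n) (λ x → ∑-cong (tuples n s) λ u → 𝟙-all?-∷ x u) ⟩
  ∑[ x ∈ allFin n ] ∑[ u ∈ tuples n s ] (𝟙 (Q? x) * 𝟙 (all? u))
    ≡⟨ ∑-cong (allFin n) (λ x → *-distribˡ-∑ (𝟙 (Q? x)) (tuples n s) _) ⟨
  ∑[ x ∈ allFin n ] (𝟙 (Q? x) * ∑[ u ∈ tuples n s ] 𝟙 (all? u))
    ≡⟨ ∑-cong (allFin n) (λ x → cong (𝟙 (Q? x) *_) (∑-tuples-all n s Q?)) ⟩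
  ∑[ x ∈ allFin n ] (𝟙 (Q? x) * c ^ s)
    ≡⟨ *-distribʳ-∑ (c ^ s) (allFin n) _ ⟨
  c * c ^ s ∎
  where
  open ≡-Reasoning
  c = count Q?
  all? : ∀ {k} (u : Fin k → Fin n) → Dec (∀ i → Q (u i))
  all? u = Finₚ.all? (Q? ∘ u)
  𝟙-all?-∷ : ∀ x u → 𝟙 (all? (x ∷ u)) ≡ 𝟙 (Q? x) * 𝟙 (all? u)
  𝟙-all?-∷ x u = 𝟙-× (Q? x) (all? u) (all? (x ∷ u)) (λ q → q zero , q ∘ suc)
    λ { qx qu zero → qx ; qx qu (suc i) → qu i }

subseqs : ∀ {r} → (Fin r → A) → ∀ k → List (Fin k → A)
subseqs w zero = List.[ [] ]
subseqs {r = zero}  w (suc k) = List.[]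
subseqs {r = suc r} w (suc k) = map (head w ∷_) (subseqs (tail w) k) ++ subseqs (tail w) (suc k)

length-subseqs : ∀ {r} (w : Fin r → A) k → length (subseqs w k) ≡ r C k
length-subseqs w zero = refl
length-subseqs {r = zero}  w (suc k) = refl
length-subseqs {r = suc r} w (suc k) = begin
  length (map (head w ∷_) (subseqs (tail w) k) ++ subseqs (tail w) (suc k))
    ≡⟨ length-++ (map (head w ∷_) (subseqs (tail w) k)) ⟩
  length (map (head w ∷_) (subseqs (tail w) k)) + length (subseqs (tail w) (suc k))
    ≡⟨ cong₂ _+_ (trans (length-map (head w ∷_) (subseqs (tail w) k)) (length-subseqs (tail w) k))
                 (length-subseqs (tail w) (suc k)) ⟩
  r C k + r C suc k
    ≡⟨ nCk+nC[k+1]≡[n+1]C[k+1] r k ⟩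
  suc r C suc k ∎
  where open ≡-Reasoning

∑-subseqs-suc : ∀ n r s (g : (Fin (suc s) → Fin n) → ℕ) →
  ∑[ w ∈ tuples n (suc r) ] ∑[ τ ∈ subseqs w (suc s) ] g τ
    ≡ ∑[ x ∈ allFin n ] ∑[ w ∈ tuples n r ] ∑[ τ ∈ subseqs w s ] g (x ∷ τ)
      + n * ∑[ w ∈ tuples n r ] ∑[ τ ∈ subseqs w (suc s) ] g τ
∑-subseqs-suc n r s g = begin
  ∑[ w ∈ tuples n (suc r) ] F w
    ≡⟨ ∑-tuples-suc n r F ⟩
  ∑[ x ∈ allFin n ] ∑[ w ∈ tuples n r ] F (x ∷ w)
    ≡⟨ ∑-cong (allFin n) (λ x → trans (∑-cong (tuples n r) (F-∷ x)) (∑-distrib-+ (tuples n r) _ F)) ⟩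
  ∑[ x ∈ allFin n ] (G x + T)
    ≡⟨ ∑-distrib-+ (allFin n) G (λ _ → T) ⟩
  ∑[ x ∈ allFin n ] G x + ∑[ _ ∈ allFin n ] T
    ≡⟨ cong (∑[ x ∈ allFin n ] G x +_) (∑-allFin-const n T) ⟩
  ∑[ x ∈ allFin n ] G x + n * T ∎
  where
  open ≡-Reasoning
  F : ∀ {m} → (Fin m → Fin n) → ℕ
  F w = ∑[ τ ∈ subseqs w (suc s) ] g τ
  G : Fin n → ℕ
  G x = ∑[ w ∈ tuples n r ] ∑[ τ ∈ subseqs w s ] g (x ∷ τ)
  T : ℕ
  T = ∑[ w ∈ tuples n r ] F w
  F-∷ : ∀ x w → F (x ∷ w) ≡ ∑[ τ ∈ subseqs w s ] g (x ∷ τ) + F w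
  F-∷ x w = trans (∑-++ (map (x ∷_) (subseqs w s)) (subseqs w (suc s)) g)
                  (cong (_+ F w) (∑-map (x ∷_) (subseqs w s) g))

-- Every s-tuple is a subsequence of (r C s) · n ^ (r ∸ s) of the r-tuples (counted with
-- positions); both sides are multiplied by n ^ s so that no subtraction occurs.
∑-subseqs : ∀ n r s (g : (Fin s → Fin n) → ℕ) →
  n ^ s * ∑[ w ∈ tuples n r ] ∑[ τ ∈ subseqs w s ] g τ ≡ (r C s) * n ^ r * ∑[ u ∈ tuples n s ] g u
∑-subseqs n r zero g = begin
  1 * ∑[ _ ∈ tuples n r ] (g [] + 0)   ≡⟨ *-identityˡ _ ⟩
  ∑[ _ ∈ tuples n r ] (g [] + 0)       ≡⟨ ∑-tuples-const n r _ ⟩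
  n ^ r * (g [] + 0)                   ≡⟨ cong (_* (g [] + 0)) (*-identityˡ (n ^ r)) ⟨
  1 * n ^ r * (g [] + 0)               ∎
  where open ≡-Reasoning
∑-subseqs n zero    (suc s) g = *-zeroʳ (n ^ suc s)
∑-subseqs n (suc r) (suc s) g = begin
  n ^ suc s * ∑[ w ∈ tuples n (suc r) ] ∑[ τ ∈ subseqs w (suc s) ] g τ
    ≡⟨ cong (n ^ suc s *_) (∑-subseqs-suc n r s g) ⟩
  n ^ suc s * (withHead + n * withoutHead)
    ≡⟨ solve 4 (λ n p a b → (n :* p) :* (a :+ n :* b) := n :* (p :* a) :+ n :* (n :* p :* b))
             refl n (n ^ s) withHead withoutHead ⟩
  n * (n ^ s * withHead) + n * (n ^ suc s * withoutHead)
    ≡⟨ cong₂ (λ a b → n * a + n * b) withHead-count (∑-subseqs n r (suc s) g) ⟩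
  n * ((r C s) * n ^ r * I) + n * ((r C suc s) * n ^ r * I)
    ≡⟨ solve 5 (λ n c d p i → n :* (c :* p :* i) :+ n :* (d :* p :* i) := (c :+ d) :* (n :* p) :* i)
             refl n (r C s) (r C suc s) (n ^ r) I ⟩
  (r C s + r C suc s) * n ^ suc r * I
    ≡⟨ cong (λ c → c * n ^ suc r * I) (nCk+nC[k+1]≡[n+1]C[k+1] r s) ⟩
  (suc r C suc s) * n ^ suc r * I ∎
  where
  open ≡-Reasoning
  open +-*-Solver
  withHead withoutHead I : ℕ
  withHead    = ∑[ x ∈ allFin n ] ∑[ w ∈ tuples n r ] ∑[ τ ∈ subseqs w s ] g (x ∷ τ)
  withoutHead = ∑[ w ∈ tuples n r ] ∑[ τ ∈ subseqs w (suc s) ] g τ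
  I           = ∑[ u ∈ tuples n (suc s) ] g u
  withHead-count : n ^ s * withHead ≡ (r C s) * n ^ r * I
  withHead-count = begin
    n ^ s * withHead
      ≡⟨ *-distribˡ-∑ (n ^ s) (allFin n) _ ⟩
    ∑[ x ∈ allFin n ] (n ^ s * ∑[ w ∈ tuples n r ] ∑[ τ ∈ subseqs w s ] g (x ∷ τ))
      ≡⟨ ∑-cong (allFin n) (λ x → ∑-subseqs n r s (g ∘ (x ∷_))) ⟩
    ∑[ x ∈ allFin n ] ((r C s) * n ^ r * ∑[ u ∈ tuples n s ] g (x ∷ u))
      ≡⟨ *-distribˡ-∑ ((r C s) * n ^ r) (allFin n) _ ⟨
    (r C s) * n ^ r * ∑[ x ∈ allFin n ] ∑[ u ∈ tuples n s ] g (x ∷ u)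
      ≡⟨ cong ((r C s) * n ^ r *_) (∑-tuples-suc n s g) ⟨
    (r C s) * n ^ r * I ∎

_∈ᵢ_ : A → ∀ {k} → (Fin k → A) → Set
x ∈ᵢ τ = ∃ λ l → τ l ≡ x

_∈ᵢ?_ : ∀ {n} (x : Fin n) {k} (τ : Fin k → Fin n) → Dec (x ∈ᵢ τ)
x ∈ᵢ? τ = Finₚ.any? λ l → τ l Finₚ.≟ x

_⊆ᵢ_ : ∀ {k m} → (Fin k → A) → (Fin m → A) → Set
τ ⊆ᵢ σ = ∀ l → τ l ∈ᵢ σ

_⊆ᵢ?_ : ∀ {n k m} (τ : Fin k → Fin n) (σ : Fin m → Fin n) → Dec (τ ⊆ᵢ σ)
τ ⊆ᵢ? σ = Finₚ.all? λ l → τ l ∈ᵢ? σ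

injection-into : ∀ {n k} {S : Fin n → Set} (S? : Decidable S) → k ≤ count S? →
                 Σ (Fin k → Fin n) λ f → Injective _≡_ _≡_ f × (∀ i → S (f i))
injection-into {k = zero} S? _ = (λ ()) , (λ { {()} }) , (λ ())
injection-into {n = zero} {suc k} S? ()
injection-into {n = suc n} {suc k} {S} S? k<c =
  select (S? zero) (≤-trans k<c (≤-reflexive (count-suc S?)))
  where
  select : (d : Dec (S zero)) → suc k ≤ 𝟙 d + count (S? ∘ suc) →
           Σ (Fin (suc k) → Fin (suc n)) λ f → Injective _≡_ _≡_ f × (∀ i → S (f i))
  select (yes s₀) k<c′ with f , f-inj , f∈S ← injection-into (S? ∘ suc) (≤-pred k<c′) =
    zero ∷ (suc ∘ f) , inj , λ { zero → s₀ ; (suc i) → f∈S i }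
    where
    inj : Injective _≡_ _≡_ (zero ∷ (suc ∘ f))
    inj {zero}  {zero}  _ = refl
    inj {suc i} {suc j} e = cong suc (f-inj (Finₚ.suc-injective e))
  select (no _) k<c′ with f , f-inj , f∈S ← injection-into (S? ∘ suc) k<c′ =
    suc ∘ f , f-inj ∘ Finₚ.suc-injective , f∈S

count-image≤ : ∀ {n k} (τ : Fin k → Fin n) → count (_∈ᵢ? τ) ≤ k
count-image≤ {k = k} τ with count (_∈ᵢ? τ) ≤? k
... | yes c≤k = c≤k
... | no c≰k with f , f-inj , f∈τ ← injection-into (_∈ᵢ? τ) (≰⇒> c≰k) =
  ⊥-elim (1+n≰n (Finₚ.injective⇒≤ preimage-inj))
  where
  preimage-inj : Injective _≡_ _≡_ (proj₁ ∘ f∈τ)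
  preimage-inj {i} {j} e = f-inj (trans (sym (proj₂ (f∈τ i))) (trans (cong τ e) (proj₂ (f∈τ j))))

⊆ᵢ-trans : ∀ {k m p} {τ : Fin k → A} {σ : Fin m → A} {ρ : Fin p → A} → τ ⊆ᵢ σ → σ ⊆ᵢ ρ → τ ⊆ᵢ ρ
⊆ᵢ-trans τ⊆σ σ⊆ρ l with i , σi≡τl ← τ⊆σ l with j , ρj≡σi ← σ⊆ρ i = j , trans ρj≡σi σi≡τl

∷-⊆ᵢ : ∀ {k m} {x : A} {τ : Fin k → A} {σ : Fin m → A} → x ∈ᵢ σ → τ ⊆ᵢ σ → (x ∷ τ) ⊆ᵢ σ
∷-⊆ᵢ x∈σ τ⊆σ zero    = x∈σ
∷-⊆ᵢ x∈σ τ⊆σ (suc l) = τ⊆σ l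

-- The witness is the subsequence of w at the positions f 0, …, f (k - 1), in increasing order.
subseqs-⊆ : ∀ {r k} (w : Fin r → A) (f : Fin k → Fin r) → Injective _≡_ _≡_ f →
            Any (_⊆ᵢ (w ∘ f)) (subseqs w k)
subseqs-⊆ {k = zero} w f _ = here λ ()
subseqs-⊆ {r = zero} {suc k} w f _ with () ← f zero
subseqs-⊆ {r = suc r} {suc k} w f f-inj = split (Finₚ.any? λ i → f i Finₚ.≟ zero)
  where
  viaTail : ∀ {m} (h : Fin m → Fin (suc k)) → Injective _≡_ _≡_ h → (avoids : ∀ j → zero ≢ f (h j)) →
            Any (_⊆ᵢ (w ∘ f)) (subseqs (tail w) m)
  viaTail h h-inj avoids = Any.map (λ τ⊆ → ⊆ᵢ-trans τ⊆ tail∘g⊆w∘f) (subseqs-⊆ (tail w) g g-inj)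
    where
    g = λ j → punchOut (avoids j)
    g-inj : Injective _≡_ _≡_ g
    g-inj e = h-inj (f-inj (Finₚ.punchOut-injective (avoids _) (avoids _) e))
    tail∘g⊆w∘f : (tail w ∘ g) ⊆ᵢ (w ∘ f)
    tail∘g⊆w∘f j = h j , cong w (sym (Finₚ.punchIn-punchOut (avoids j)))
  split : Dec (∃ λ i → f i ≡ zero) → Any (_⊆ᵢ (w ∘ f)) (subseqs w (suc k))
  split (yes (i₀ , fi₀≡0)) = ++⁺ˡ (map⁺ (Any.map (∷-⊆ᵢ (i₀ , cong w fi₀≡0))
    (viaTail (punchIn i₀) (Finₚ.punchIn-injective i₀ _ _) λ j 0≡f →
      Finₚ.punchInᵢ≢i i₀ j (f-inj (trans (sym 0≡f) (sym fi₀≡0))))))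
  split (no ∄) = ++⁺ʳ _ (viaTail id id λ j 0≡f → ∄ (j , sym 0≡f))

subseqs-⊇ : ∀ {r k} (w : Fin r → A) {S : Fin r → Set} (S? : Decidable S) → count S? ≤ k → k ≤ r →
            Any (λ τ → ∀ x → S x → w x ∈ᵢ τ) (subseqs w k)
subseqs-⊇ {r = zero}  {zero} w S? _ _ = here λ ()
subseqs-⊇ {r = suc r} {zero} w S? c≤0 _ = here λ x sx → ⊥-elim (1+n≰n (≤-trans (count≥1 S? sx) c≤0))
subseqs-⊇ {A = A} {suc r} {suc k} w {S} S? c≤k k≤r with count (S? ∘ suc) ≤? k
... | yes c′≤k = ++⁺ˡ (map⁺ (Any.map keepHead (subseqs-⊇ (tail w) (S? ∘ suc) c′≤k (≤-pred k≤r))))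
  where
  keepHead : ∀ {τ : Fin k → A} → (∀ x → S (suc x) → tail w x ∈ᵢ τ) → ∀ x → S x → w x ∈ᵢ (head w ∷ τ)
  keepHead _     zero    _  = zero , refl
  keepHead cover (suc x) sx = let l , e = cover x sx in suc l , e
... | no c′≰k = ++⁺ʳ _ (Any.map dropHead
        (subseqs-⊇ (tail w) (S? ∘ suc) c′≤1+k (≤-trans (≰⇒> c′≰k) (count≤n (S? ∘ suc)))))
  where
  c′≤1+k : count (S? ∘ suc) ≤ suc k
  c′≤1+k = ≤-trans (m≤n+m _ (𝟙 (S? zero))) (≤-trans (≤-reflexive (sym (count-suc S?))) c≤k)
  dropHead : ∀ {τ : Fin (suc k) → A} → (∀ x → S (suc x) → tail w x ∈ᵢ τ) → ∀ x → S x → w x ∈ᵢ τ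
  dropHead _     zero    s₀ = ⊥-elim (c′≰k (≤-pred (begin
    suc (count (S? ∘ suc))               ≡⟨ cong (_+ count (S? ∘ suc)) (𝟙-yes (S? zero) s₀) ⟨
    𝟙 (S? zero) + count (S? ∘ suc)       ≡⟨ count-suc S? ⟨
    count S?                             ≤⟨ c≤k ⟩
    suc k                                ∎)))
    where open ≤-Reasoning
  dropHead cover (suc x) sx = cover x sx

-- Counting independent tuples

pullback : ∀ {n r} → (Fin r → Fin n) → SimpleGraph n → SimpleGraph r
pullback w G = record
  { adj    = λ i j → adj G (w i) (w j)
  ; sym    = λ i j → SimpleGraph.sym G (w i) (w j)
  ; irrefl = λ i → irrefl G (w i)
  }

clique-pullback : ∀ {n r t} (w : Fin r → Fin n) (G : SimpleGraph n) →
                  HasClique (pullback w G) t → HasClique G t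
clique-pullback w G (f , _ , clique) = w ∘ f , inj , clique
  where
  inj : Injective _≡_ _≡_ (w ∘ f)
  inj {i} {j} e with i Finₚ.≟ j
  ... | yes i≡j = i≡j
  ... | no i≢j  = ⊥-elim (true≢false (begin
    true                       ≡⟨ clique i j i≢j ⟨
    adj G (w (f i)) (w (f j))  ≡⟨ cong (λ v → adj G v (w (f j))) e ⟩
    adj G (w (f j)) (w (f j))  ≡⟨ irrefl G (w (f j)) ⟩
    false                      ∎))
    where
    open ≡-Reasoning
    true≢false : true ≢ false
    true≢false ()

independent-⊆ᵢ : ∀ {n k m} (G : SimpleGraph n) {σ : Fin m → Fin n} {τ : Fin k → Fin n} →
                 (∀ i j → i ≢ j → adj G (σ i) (σ j) ≡ false) → τ ⊆ᵢ σ → IsIndependentTuple G τ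
independent-⊆ᵢ G {σ} σ-indep τ⊆σ l l′ with i , σi≡τl ← τ⊆σ l with j , σj≡τl′ ← τ⊆σ l′ =
  subst₂ (λ u v → adj G u v ≡ false) σi≡τl σj≡τl′ (non-adjacent i j)
  where
  non-adjacent : ∀ i j → adj G (σ i) (σ j) ≡ false
  non-adjacent i j with i Finₚ.≟ j
  ... | yes refl = irrefl G (σ i)
  ... | no i≢j   = σ-indep i j i≢j

independent-subseq : ∀ {n r s t} (G : SimpleGraph n) → RamseyProperty s t r → CliqueFree G t →
                     (w : Fin r → Fin n) → Any (IsIndependentTuple G) (subseqs w s)
independent-subseq G ramsey cliqueFree w with ramsey (pullback w G)
... | inj₁ (f , f-inj , indep) = Any.map (independent-⊆ᵢ G indep) (subseqs-⊆ w f f-inj)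
... | inj₂ clique               = ⊥-elim (cliqueFree (clique-pullback w G clique))

countTuples-lowerBound : ∀ n r s .{{_ : NonZero n}} {P : (Fin s → Fin n) → Set} (P? : Decidable P) →
                         (∀ w → Any P (subseqs w s)) → n ^ s ≤ (r C s) * countTuples n s P?
countTuples-lowerBound n r s P? hasSubseq = *-cancelʳ-≤ (n ^ s) ((r C s) * I) (n ^ r) {{m^n≢0 n r}} (begin
  n ^ s * n ^ r
    ≡⟨ cong (n ^ s *_) (trans (∑-tuples-const n r 1) (*-identityʳ (n ^ r))) ⟨
  n ^ s * ∑[ _ ∈ tuples n r ] 1
    ≤⟨ *-monoʳ-≤ (n ^ s) (∑-mono (tuples n r) λ w → ∑-𝟙-Any P? (hasSubseq w)) ⟩
  n ^ s * ∑[ w ∈ tuples n r ] ∑[ τ ∈ subseqs w s ] 𝟙 (P? τ)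
    ≡⟨ ∑-subseqs n r s (𝟙 ∘ P?) ⟩
  (r C s) * n ^ r * ∑[ u ∈ tuples n s ] 𝟙 (P? u)
    ≡⟨ cong ((r C s) * n ^ r *_) (countTuples≡∑𝟙 n s P?) ⟨
  (r C s) * n ^ r * I
    ≡⟨ *-xy∙z≈xz∙y (r C s) (n ^ r) I ⟩
  (r C s) * I * n ^ r ∎)
  where
  open ≤-Reasoning
  I = countTuples n s P?

independent-image≤ : ∀ {n s k} (G : SimpleGraph n) {u : Fin s → Fin n} →
                     ¬ HasIndependentSet G (suc k) → IsIndependentTuple G u → count (_∈ᵢ? u) ≤ k
independent-image≤ {k = k} G {u} noIndep u-indep with count (_∈ᵢ? u) ≤? k
... | yes c≤k = c≤k
... | no c≰k with f , f-inj , f∈u ← injection-into (_∈ᵢ? u) (≰⇒> c≰k) =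
  ⊥-elim (noIndep (f , f-inj , λ i j _ →
    subst₂ (λ x y → adj G x y ≡ false) (proj₂ (f∈u i)) (proj₂ (f∈u j)) (u-indep _ _)))

countTuples-upperBound : ∀ {n} s k (G : SimpleGraph n) → ¬ HasIndependentSet G (suc k) → k ≤ n →
                         countTuples n s (isIndependentTuple? G) ≤ (n C k) * k ^ s
countTuples-upperBound {n} s k G noIndep k≤n = begin
  countTuples n s Indep?                            ≡⟨ countTuples≡∑𝟙 n s Indep? ⟩
  ∑[ u ∈ tuples n s ] 𝟙 (Indep? u)                  ≤⟨ ∑-mono (tuples n s) covered ⟩
  ∑[ u ∈ tuples n s ] ∑[ τ ∈ ksets ] 𝟙 (u ⊆ᵢ? τ)    ≡⟨ ∑-comm (tuples n s) ksets _ ⟩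
  ∑[ τ ∈ ksets ] ∑[ u ∈ tuples n s ] 𝟙 (u ⊆ᵢ? τ)    ≡⟨ ∑-cong ksets (λ τ → ∑-tuples-all n s (_∈ᵢ? τ)) ⟩
  ∑[ τ ∈ ksets ] (count (_∈ᵢ? τ) ^ s)              ≤⟨ ∑-mono ksets (λ τ → ^-monoˡ-≤ s (count-image≤ τ)) ⟩
  ∑[ _ ∈ ksets ] (k ^ s)                           ≡⟨ ∑-const ksets (k ^ s) ⟩
  length ksets * k ^ s                             ≡⟨ cong (_* k ^ s) (length-subseqs id k) ⟩
  (n C k) * k ^ s                                  ∎
  where
  open ≤-Reasoning
  Indep? = isIndependentTuple? {n} {s} G
  ksets = subseqs id k
  covered : ∀ u → 𝟙 (Indep? u) ≤ ∑[ τ ∈ ksets ] 𝟙 (u ⊆ᵢ? τ)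
  covered u with Indep? u
  ... | no _       = z≤n
  ... | yes u-indep = ∑-𝟙-Any (u ⊆ᵢ?_) (Any.map (λ cover l → cover (u l) (l , refl))
          (subseqs-⊇ id (_∈ᵢ? u) (independent-image≤ G noIndep u-indep) k≤n))

-- Ramsey graphs by exhaustive search

Searchable : Set → Set₁
Searchable A = ∀ {P : A → Set} → Decidable P → Dec (∃ P)

searchVec : Searchable A → ∀ k → Searchable (Vec A k)
searchVec search zero    P? = map′ (Vec.[] ,_) (λ { (Vec.[] , p) → p }) (P? Vec.[])
searchVec search (suc k) P? = map′ (λ (x , v , p) → x Vec.∷ v , p) (λ { (x Vec.∷ v , p) → x , v , p })
  (search λ x → searchVec search k (P? ∘ (x Vec.∷_)))

Homogeneous : ∀ {n k} → SimpleGraph n → Bool → (Fin k → Fin n) → Set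
Homogeneous G b f = Injective _≡_ _≡_ f × (∀ i j → i ≢ j → adj G (f i) (f j) ≡ b)

homogeneous? : ∀ {n k} (G : SimpleGraph n) b → Decidable (Homogeneous {k = k} G b)
homogeneous? G b f = injective? ×-dec
  (Finₚ.all? λ i → Finₚ.all? λ j → ¬? (i Finₚ.≟ j) →-dec (adj G (f i) (f j) ≟ᵇ b))
  where
  injective? : Dec (Injective _≡_ _≡_ f)
  injective? = map′ (λ inj {i} {j} → inj i j) (λ inj i j → inj)
    (Finₚ.all? λ i → Finₚ.all? λ j → (f i Finₚ.≟ f j) →-dec (i Finₚ.≟ j))

homogeneous-transfer : ∀ {n k b} (G H : SimpleGraph n) {f g : Fin k → Fin n} →
  (∀ u v → adj G u v ≡ adj H u v) → (∀ i → f i ≡ g i) → Homogeneous G b f → Homogeneous H b g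
homogeneous-transfer {b = b} G H {f} {g} G≗H f≗g (f-inj , hom) =
  (λ {i} {j} e → f-inj (trans (f≗g i) (trans e (sym (f≗g j))))) ,
  λ i j i≢j → trans (sym (G≗H (g i) (g j))) (subst₂ (λ u v → adj G u v ≡ b) (f≗g i) (f≗g j) (hom i j i≢j))

anyHomogeneous? : ∀ {n} (G : SimpleGraph n) k b → Dec (∃ (Homogeneous {k = k} G b))
anyHomogeneous? G k b = map′ (λ (v , hom) → lookup v , hom)
  (λ (f , hom) → tabulate f , homogeneous-transfer G G (λ _ _ → refl) (λ i → sym (Vecₚ.lookup∘tabulate f i)) hom)
  (searchVec Finₚ.any? k (homogeneous? G b ∘ lookup))

IsRamseyGraph : ∀ {n} → ℕ → ℕ → SimpleGraph n → Set
IsRamseyGraph s t H = ¬ HasIndependentSet H s × CliqueFree H t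

isRamseyGraph? : ∀ {n} s t → Decidable (IsRamseyGraph {n} s t)
isRamseyGraph? s t H = ¬? (anyHomogeneous? H s false) ×-dec ¬? (anyHomogeneous? H t true)

-- A graph is found from ¬ RamseyProperty only by search; adjacency matrices form a finite
-- type to search, and every graph is recovered from its matrix.
Matrix : ℕ → Set
Matrix n = Vec (Subset n) n

entry : ∀ {n} → Matrix n → Fin n → Fin n → Bool
entry ρ u v = lookup (lookup ρ u) v

IsAdjacencyMatrix : ∀ {n} → Matrix n → Set
IsAdjacencyMatrix ρ = (∀ u v → entry ρ u v ≡ entry ρ v u) × (∀ v → entry ρ v v ≡ false)

isAdjacencyMatrix? : ∀ {n} → Decidable (IsAdjacencyMatrix {n})
isAdjacencyMatrix? ρ = (Finₚ.all? λ u → Finₚ.all? λ v → entry ρ u v ≟ᵇ entry ρ v u)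
                ×-dec (Finₚ.all? λ v → entry ρ v v ≟ᵇ false)

fromMatrix : ∀ {n} (ρ : Matrix n) → IsAdjacencyMatrix ρ → SimpleGraph n
fromMatrix ρ isAdj = record { adj = entry ρ ; sym = proj₁ isAdj ; irrefl = proj₂ isAdj }

toMatrix : ∀ {n} → SimpleGraph n → Matrix n
toMatrix G = tabulate λ u → tabulate λ v → adj G u v

entry-toMatrix : ∀ {n} (G : SimpleGraph n) u v → entry (toMatrix G) u v ≡ adj G u v
entry-toMatrix G u v = trans (cong (λ row → lookup row v) (Vecₚ.lookup∘tabulate _ u))
                             (Vecₚ.lookup∘tabulate _ v)

toMatrix-isAdjacencyMatrix : ∀ {n} (G : SimpleGraph n) → IsAdjacencyMatrix (toMatrix G)
toMatrix-isAdjacencyMatrix G =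
  (λ u v → trans (entry-toMatrix G u v) (trans (SimpleGraph.sym G u v) (sym (entry-toMatrix G v u)))) ,
  (λ v → trans (entry-toMatrix G v v) (irrefl G v))

RamseyMatrix : ∀ {n} → ℕ → ℕ → Matrix n → Set
RamseyMatrix s t ρ = Σ (IsAdjacencyMatrix ρ) λ isAdj → IsRamseyGraph s t (fromMatrix ρ isAdj)

ramseyMatrix? : ∀ {n} s t → Decidable (RamseyMatrix {n} s t)
ramseyMatrix? s t ρ with isAdjacencyMatrix? ρ
... | no ¬isAdj = no (¬isAdj ∘ proj₁)
-- proj₂ applies because fromMatrix ρ isAdj′ has adjacency entry ρ whatever isAdj′ is.
... | yes isAdj = map′ (isAdj ,_) proj₂ (isRamseyGraph? s t (fromMatrix ρ isAdj))

ramseyGraph : ∀ {s t n} → ¬ RamseyProperty s t n → Σ (SimpleGraph n) (IsRamseyGraph s t)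
ramseyGraph {s} {t} {n} notRamsey with searchVec anySubset? n (ramseyMatrix? s t)
... | yes (ρ , isAdj , isRamsey) = fromMatrix ρ isAdj , isRamsey
... | no ∄ = ⊥-elim (notRamsey ramsey)
  where
  roundTrip : SimpleGraph n → SimpleGraph n
  roundTrip G = fromMatrix (toMatrix G) (toMatrix-isAdjacencyMatrix G)
  fromRoundTrip : ∀ {k b} (G : SimpleGraph n) → ∃ (Homogeneous {k = k} (roundTrip G) b) → ∃ (Homogeneous G b)
  fromRoundTrip G (f , hom) = f , homogeneous-transfer (roundTrip G) G (entry-toMatrix G) (λ _ → refl) hom
  ramsey : RamseyProperty s t n
  ramsey G with anyHomogeneous? G s false | anyHomogeneous? G t true
  ... | yes indep  | _          = inj₁ indep
  ... | no _       | yes clique = inj₂ clique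
  ... | no ¬indep  | no ¬clique = ⊥-elim (∄ (toMatrix G , toMatrix-isAdjacencyMatrix G ,
                                             ¬indep ∘ fromRoundTrip G , ¬clique ∘ fromRoundTrip G))

emptyGraph : ∀ n → SimpleGraph n
emptyGraph n = record { adj = λ _ _ → false ; sym = λ _ _ → refl ; irrefl = λ _ → refl }

ramseyProperty⇒≤ : ∀ {s t r} → 2 ≤ t → RamseyProperty s t r → s ≤ r
ramseyProperty⇒≤ {r = r} (s≤s (s≤s z≤n)) ramsey with ramsey (emptyGraph r)
... | inj₁ (_ , f-inj , _)  = Finₚ.injective⇒≤ f-inj
... | inj₂ (_ , _ , clique) with () ← clique zero (suc zero) (λ ())

frac-toℚᵘ : ∀ p q → toℚᵘ (frac p (suc q)) ≃ᵘ mkℚᵘ (ℤ.+ p) q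
frac-toℚᵘ p q = ℚₚ.toℚᵘ-fromℚᵘ (mkℚᵘ (ℤ.+ p) q)

frac≤frac : ∀ p q p′ q′ .{{_ : NonZero q′}} → p * q′ ≤ p′ * q → frac p q ≤ℚ frac p′ q′
frac≤frac p zero    p′ (suc q′) _ = ℚₚ.nonNegative⁻¹ _ {{ℚₚ.normalize-nonNeg p′ (suc q′)}}
frac≤frac p (suc q) p′ (suc q′) pq′≤p′q = ℚₚ.toℚᵘ-cancel-≤
  (ℚᵘₚ.≤-respˡ-≃ (ℚᵘₚ.≃-sym (frac-toℚᵘ p q)) (ℚᵘₚ.≤-respʳ-≃ (ℚᵘₚ.≃-sym (frac-toℚᵘ p′ q′))
    (*≤* (subst₂ ℤ._≤_ (ℤₚ.pos-* p (suc q′)) (ℤₚ.pos-* p′ (suc q)) (ℤ.+≤+ pq′≤p′q)))))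

frac-* : ∀ p q p′ q′ .{{_ : NonZero q}} .{{_ : NonZero q′}} → frac p q *ℚ frac p′ q′ ≡ frac (p * p′) (q * q′)
frac-* p (suc q) p′ (suc q′) = ℚₚ.toℚᵘ-injective (begin
  toℚᵘ (frac p (suc q) *ℚ frac p′ (suc q′))
    ≈⟨ ℚₚ.toℚᵘ-homo-* (frac p (suc q)) (frac p′ (suc q′)) ⟩
  toℚᵘ (frac p (suc q)) ℚᵘ.* toℚᵘ (frac p′ (suc q′))
    ≈⟨ ℚᵘₚ.*-cong (frac-toℚᵘ p q) (frac-toℚᵘ p′ q′) ⟩
  mkℚᵘ (ℤ.+ p) q ℚᵘ.* mkℚᵘ (ℤ.+ p′) q′
    ≈⟨ *≡* (cong (ℤ._* ℤ.+ suc (q′ + q * suc q′)) (sym (ℤₚ.pos-* p p′))) ⟩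
  mkℚᵘ (ℤ.+ (p * p′)) (q′ + q * suc q′)
    ≈⟨ frac-toℚᵘ (p * p′) (q′ + q * suc q′) ⟨
  toℚᵘ (frac (p * p′) (suc q * suc q′)) ∎)
  where open ℚᵘₚ.≃-Reasoning

frac-^ : ∀ p q s .{{_ : NonZero q}} → frac p q ^ℚ s ≡ frac (p ^ s) (q ^ s)
frac-^ p q zero    = refl
frac-^ p q (suc s) = trans (cong (frac p q *ℚ_) (frac-^ p q s)) (frac-* p q (p ^ s) (q ^ s))
  where instance _ = m^n≢0 q s

indepProb-lowerBound : ∀ {s t r m} (G : SimpleGraph (suc m)) → RamseyProperty s t r → CliqueFree G t →
                       frac 1 (r C s) ≤ℚ indepProb G s
indepProb-lowerBound {s} {t} {r} {m} G ramsey cliqueFree = frac≤frac 1 (r C s) I (n ^ s) (begin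
  1 * n ^ s       ≡⟨ *-identityˡ (n ^ s) ⟩
  n ^ s           ≤⟨ countTuples-lowerBound n r s (isIndependentTuple? G) (independent-subseq G ramsey cliqueFree) ⟩
  (r C s) * I     ≡⟨ *-comm (r C s) I ⟩
  I * (r C s)     ∎)
  where
  open ≤-Reasoning
  n = suc m
  I = countTuples n s (isIndependentTuple? G)
  instance _ = m^n≢0 n s

indepProb-upperBound : ∀ {m} s k (H : SimpleGraph (suc m)) → ¬ HasIndependentSet H (suc k) → k ≤ suc m →
                       indepProb H s ≤ℚ frac (suc m C k) 1 *ℚ (frac k (suc m) ^ℚ s)
indepProb-upperBound {m} s k H noIndep k≤n = begin
  indepProb H s                                ≤⟨ frac≤frac I (n ^ s) ((n C k) * k ^ s) (1 * n ^ s)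
                                                    (≤-trans (≤-reflexive (cong (I *_) (*-identityˡ (n ^ s))))
                                                      (*-monoˡ-≤ (n ^ s) (countTuples-upperBound s k H noIndep k≤n))) ⟩
  frac ((n C k) * k ^ s) (1 * n ^ s)           ≡⟨ frac-* (n C k) 1 (k ^ s) (n ^ s) ⟨
  frac (n C k) 1 *ℚ frac (k ^ s) (n ^ s)       ≡⟨ cong (frac (n C k) 1 *ℚ_) (frac-^ k n s) ⟨
  frac (n C k) 1 *ℚ (frac k n ^ℚ s)            ∎
  where
  open ℚₚ.≤-Reasoning
  n = suc m
  I = countTuples n s (isIndependentTuple? H)
  instance
    _ = m^n≢0 n s
    _ = m*n≢0 1 (n ^ s)

q<q+ε : ∀ q {ε} → 0ℚ <ℚ ε → q <ℚ q +ℚ ε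
q<q+ε q ε>0 = subst (_<ℚ q +ℚ _) (ℚₚ.+-identityʳ q) (ℚₚ.+-monoʳ-< q ε>0)

-- The (a,t)-Ramsey graph itself attains the bound.
indepProb-upperBound-ε : ∀ {s t a r} → 2 ≤ a → 2 ≤ t → IsRamseyNumber a t r → (ε : ℚ) → 0ℚ <ℚ ε →
  Σ ℕ λ m → Σ (SimpleGraph (suc m)) λ G → CliqueFree G t ×
    (indepProb G s <ℚ (frac ((r ∸ 1) C (a ∸ 1)) 1 *ℚ (frac (a ∸ 1) (r ∸ 1) ^ℚ s)) +ℚ ε)
indepProb-upperBound-ε {s} {t} {suc (suc k)} (s≤s (s≤s z≤n)) t≥2 (ramsey , minimal) ε ε>0
  with ramseyProperty⇒≤ t≥2 ramsey
... | s≤s (s≤s {n = m} k≤m) with H , noIndep , cliqueFree ← ramseyGraph (1+n≰n ∘ minimal (suc m)) =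
  m , H , cliqueFree , ℚₚ.≤-<-trans (indepProb-upperBound s (suc k) H noIndep (s≤s k≤m)) (q<q+ε _ ε>0)

mainTheorem4 : (s t : ℕ) → 1 ≤ s → 2 ≤ t →
      ((r : ℕ) → IsRamseyNumber s t r →
        (m : ℕ) (G : SimpleGraph (suc m)) → CliqueFree G t →
        frac 1 (r C s) ≤ℚ indepProb G s)
    × ((a : ℕ) → 2 ≤ a → a < s → (r : ℕ) → IsRamseyNumber a t r →
        (ε : ℚ) → 0ℚ <ℚ ε →
        Σ ℕ λ m → Σ (SimpleGraph (suc m)) λ G → CliqueFree G t ×
          (indepProb G s <ℚ (frac ((r ∸ 1) C (a ∸ 1)) 1 *ℚ (frac (a ∸ 1) (r ∸ 1) ^ℚ s)) +ℚ ε))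
mainTheorem4 s t _ t≥2 =
  (λ r (ramsey , _) m G cliqueFree → indepProb-lowerBound G ramsey cliqueFree) ,
  (λ a a≥2 _ r isRamsey → indepProb-upperBound-ε {s} a≥2 t≥2 isRamsey)
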